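{- For every $\varepsilon>0$ there is a graph $G$ such that $$\frac{\operatorname{mdim}(G)}{\operatorname{cdim}(G)}\leq \varepsilon.$$
   Context: All graphs are nonempty, finite, simple and undirected. For distinct vertices $v,w$ of a graph $G$, $\kappa(v,w)$ denotes the maximum number of internally vertex-disjoint $v$–$w$ paths in $G$; by convention $\kappa(v,v)=\infty$. For an ordered vertex set $W=\{w_1,\ldots,w_k\}\subseteq V(G)$, the connectivity representation of $v$ is $r(v,W)=[\kappa(v,w_1),\ldots,\kappa(v,w_k)]$. $W$ is resolving for $G$ if $r(v_1,W)=r(v_2,W)$ implies $v_1=v_2$ for all $v_1,v_2\in V(G)$. The connectivity dimension $\operatorname{cdim}(G)$ is the minimum cardinality of a resolving set of $G$. The metric dimension $\operatorname{mdim}(G)$ is defined analogously with the distance $d(v,w)$ in place of $\kappa(v,w)$: it is the minimum cardinality of a set $W=\{w_1,\ldots,w_k\}$ such that the vectors $[d(v,w_1),\ldots,d(v,w_k)]$, $v\in V(G)$, are pairwise distinct.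
   Formalization: The parameter ε ranges over the positive rationals. -}

module Defs where

open import Data.Nat using (ℕ; zero; suc; _≤_)
open import Data.Fin using (Fin)
open import Data.Bool using (Bool; T)
open import Data.List using (List; []; _∷_; _++_)
open import Data.List.Relation.Unary.Linked using (Linked)
open import Data.List.Relation.Unary.Unique.Propositional using (Unique)
open import Data.List.Membership.Propositional using (_∈_)
open import Data.Maybe using (Maybe; just; nothing)
open import Data.Product using (Σ; ∃; _×_)
open import Data.Empty using (⊥)
open import Relation.Nullary using (¬_)
open import Relation.Binary.PropositionalEquality using (_≡_; _≢_)

record Graph : Set where
  field
    n        : ℕ
    nonempty : 1 ≤ n
    adj      : Fin n → Fin n → Bool
    adj-sym  : ∀ u v → adj u v ≡ adj v u
    adj-irr  : ∀ v → adj v v ≡ Bool.false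

open Graph public

module _ (G : Graph) where

  V : Set
  V = Fin (n G)

  Adj : V → V → Set
  Adj u v = T (adj G u v)

  data Walk : V → V → ℕ → Set where
    here : ∀ {v} → Walk v v 0
    step : ∀ {u x w d} → Adj u x → Walk x w d → Walk u w (suc d)

  Connected : Set
  Connected = ∀ v w → ∃ λ d → Walk v w d

  DistIs : V → V → ℕ → Set
  DistIs v w d = Walk v w d × (∀ e → Walk v w e → d ≤ e)

  IsPath : V → V → List V → Set
  IsPath v w int = Linked Adj (v ∷ int ++ w ∷ []) × Unique (v ∷ int ++ w ∷ [])

  HasDisjointPaths : V → V → ℕ → Set
  HasDisjointPaths v w k =
    Σ (Fin k → List V) λ P →
      (∀ i → IsPath v w (P i)) ×
      (∀ i j → P i ≡ P j → i ≡ j) ×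
      (∀ i j → i ≢ j → ∀ x → x ∈ P i → x ∈ P j → ⊥)

  KappaIs : V → V → ℕ → Set
  KappaIs v w k = v ≢ w × HasDisjointPaths v w k × (∀ m → HasDisjointPaths v w m → m ≤ k)

  -- κ(v,w) with values in ℕ ∪ {∞}, ∞ represented by `nothing`
  ConnIs : V → V → Maybe ℕ → Set
  ConnIs v w nothing  = v ≡ w
  ConnIs v w (just k) = KappaIs v w k

  -- W = (w_1..w_k) resolves G w.r.t. a (functional) vertex invariant R(v,w,value):
  -- equal representation vectors imply equal vertices
  Resolves : {A : Set} → (V → V → A → Set) → {k : ℕ} → (Fin k → V) → Set
  Resolves R {k} W = ∀ v₁ v₂ →
    (∀ i x y → R v₁ (W i) x → R v₂ (W i) y → x ≡ y) → v₁ ≡ v₂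

  IsDimension : {A : Set} → (V → V → A → Set) → ℕ → Set
  IsDimension R d =
    (Σ (Fin d → V) λ W → (∀ i j → W i ≡ W j → i ≡ j) × Resolves R W) ×
    (∀ k (W : Fin k → V) → (∀ i j → W i ≡ W j → i ≡ j) → Resolves R W → d ≤ k)

  IsMDim : ℕ → Set
  IsMDim = IsDimension DistIs

  IsCDim : ℕ → Set
  IsCDim = IsDimension ConnIs

{-# OPTIONS --safe #-}
module Submission where

-- The path on q + 1 vertices has metric dimension 1: distances to an end vertex are the vertex
-- labels. Its connectivity dimension is q. Along a path from v to w the labels move by ±1, so
-- they pass through every value between the first step and w (a discrete intermediate value
-- theorem); since v is not revisited, the first step must head towards w. Hence any two v–w paths
-- share their first step, κ(v, w) = 1 for all v ≠ w, a vertex's connectivity representation only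
-- records whether it belongs to W, and a connectivity-resolving set can miss at most one vertex.
-- So mdim / cdim = 1 / q ≤ p / q.

open import Defs
open import Data.Nat using (ℕ; zero; suc; _+_; _*_; _≤_; _<_; z≤n; s≤s; _≡ᵇ_)
open import Data.Nat.Properties
  using ( ≤-refl; ≤-trans; ≤-reflexive; ≤-antisym; ≤-pred; ≤∧≢⇒<; ≤-total; n≤1+n; m≤m+n; m≤n+m
        ; <-trans; <-irrefl; <-cmp; +-suc; m∸n+n≡m; *-monoˡ-≤; suc-injective; ≡ᵇ⇒≡; ≡⇒≡ᵇ )
  renaming (_≟_ to _≟ℕ_)
open import Data.Fin using (Fin; zero; suc; toℕ; fromℕ; fromℕ<; inject₁; lower₁)
open import Data.Fin.Properties
  using (toℕ-injective; toℕ<n; toℕ-fromℕ; toℕ-fromℕ<; inject₁-injective; inject₁-lower₁; injective⇒≤; any?; 0≢1+n)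
  renaming (_≟_ to _≟ᶠ_; suc-injective to suc-injectiveᶠ)
open import Data.Bool using (Bool; false; T; _∨_)
open import Data.Bool.Properties using (∨-comm; T-∨)
open import Data.List using (List; []; _∷_; _++_)
open import Data.List.Relation.Unary.Linked as Linked using (Linked; [-]; _∷_)
open import Data.List.Relation.Unary.Linked.Properties using (Linked⇒AllPairs)
import Data.List.Relation.Unary.AllPairs as AllPairs
open import Data.List.Relation.Unary.AllPairs using (_∷_)
import Data.List.Relation.Unary.All as All
open import Data.List.Relation.Unary.All using ([]; _∷_)
open import Data.List.Relation.Unary.Any using (here; there)
open import Data.List.Relation.Unary.Unique.Propositional using (Unique)
open import Data.List.Membership.Propositional using (_∈_)
open import Data.List.Membership.Propositional.Properties using (∈-++⁺ʳ)
open import Data.Maybe using (just; nothing)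
open import Data.Product using (Σ; ∃; _×_; _,_; proj₁; proj₂; map₂)
open import Data.Sum using (_⊎_; inj₁; inj₂)
import Data.Sum as Sum
open import Data.Empty using (⊥-elim)
open import Function using (_∘_; _on_; flip; case_of_; Equivalence)
open import Level using (Level)
open import Relation.Nullary using (¬_; yes; no)
open import Relation.Binary.Core using (Rel)
open import Relation.Binary.Definitions using (Transitive; tri<; tri≈; tri>)
open import Relation.Binary.PropositionalEquality using (_≡_; _≢_; refl; sym; trans; cong; cong₂; subst)

Neighbours : ℕ → ℕ → Set
Neighbours a b = a ≡ suc b ⊎ b ≡ suc a

Between : ℕ → ℕ → ℕ → Set
Between a c d = (a ≤ c × c ≤ d) ⊎ (d ≤ c × c ≤ a)

Neighbours⇒≤1+ : ∀ {a b} → Neighbours a b → a ≤ suc b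
Neighbours⇒≤1+ (inj₁ refl) = ≤-refl
Neighbours⇒≤1+ (inj₂ refl) = ≤-trans (n≤1+n _) (n≤1+n _)

Between-step : ∀ {a b c d} → Neighbours a b → Between a c d → c ≢ a → Between b c d
Between-step (inj₁ refl) (inj₁ (a≤c , c≤d)) _   = inj₁ (≤-trans (n≤1+n _) a≤c , c≤d)
Between-step (inj₁ refl) (inj₂ (d≤c , c≤a)) c≢a = inj₂ (d≤c , ≤-pred (≤∧≢⇒< c≤a c≢a))
Between-step (inj₂ refl) (inj₁ (a≤c , c≤d)) c≢a = inj₁ (≤∧≢⇒< a≤c (c≢a ∘ sym) , c≤d)
Between-step (inj₂ refl) (inj₂ (d≤c , c≤a)) _   = inj₂ (d≤c , ≤-trans c≤a (n≤1+n _))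

Between-self⇒≡ : ∀ {b c} → Between b c b → c ≡ b
Between-self⇒≡ (inj₁ (b≤c , c≤b)) = ≤-antisym c≤b b≤c
Between-self⇒≡ (inj₂ (b≤c , c≤b)) = ≤-antisym c≤b b≤c

forward-neighbour-unique : ∀ {v a b w} → Neighbours v a → Neighbours v b →
                           ¬ Between a v w → ¬ Between b v w → a ≡ b
forward-neighbour-unique (inj₁ refl) (inj₁ v≡1+b) _ _ = suc-injective v≡1+b
forward-neighbour-unique (inj₂ refl) (inj₂ refl)  _ _ = refl
forward-neighbour-unique {v} {w = w} (inj₁ refl) (inj₂ refl) a∦ b∦ with ≤-total v w
... | inj₁ v≤w = ⊥-elim (a∦ (inj₁ (n≤1+n _ , v≤w)))
... | inj₂ w≤v = ⊥-elim (b∦ (inj₂ (w≤v , n≤1+n _)))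
forward-neighbour-unique {v} {w = w} (inj₂ refl) (inj₁ refl) a∦ b∦ with ≤-total v w
... | inj₁ v≤w = ⊥-elim (b∦ (inj₁ (n≤1+n _ , v≤w)))
... | inj₂ w≤v = ⊥-elim (a∦ (inj₂ (w≤v , n≤1+n _)))

Misses : {A : Set} {k : ℕ} → (Fin k → A) → A → Set
Misses W v = ∀ i → W i ≢ v

MissesAtMostOne : {A : Set} {k : ℕ} → (Fin k → A) → Set
MissesAtMostOne W = ∀ {a b} → Misses W a → Misses W b → a ≡ b

hit-or-missed : ∀ {k n} (W : Fin k → Fin n) v → (∃ λ i → W i ≡ v) ⊎ Misses W v
hit-or-missed W v with any? (λ i → W i ≟ᶠ v)
... | yes hit = inj₁ hit
... | no ¬hit = inj₂ (λ i Wi≡v → ¬hit (i , Wi≡v))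

misses-at-most-one⇒≤1+ : ∀ {k n} (W : Fin k → Fin n) → MissesAtMostOne W → n ≤ suc k
misses-at-most-one⇒≤1+ {k} W one =
  injective⇒≤ {f = code ∘ hit-or-missed W} (λ {a} {b} → code-injective (hit-or-missed W a) (hit-or-missed W b))
  where
  code : ∀ {v} → (∃ λ i → W i ≡ v) ⊎ Misses W v → Fin (suc k)
  code (inj₁ (i , _)) = suc i
  code (inj₂ _)       = zero

  code-injective : ∀ {a b} (ha : (∃ λ i → W i ≡ a) ⊎ Misses W a) (hb : (∃ λ i → W i ≡ b) ⊎ Misses W b) →
                   code ha ≡ code hb → a ≡ b
  code-injective (inj₁ (i , refl)) (inj₁ (j , refl)) eq = cong W (suc-injectiveᶠ eq)
  code-injective (inj₂ ma)         (inj₂ mb)         _  = one ma mb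
  code-injective (inj₁ _)          (inj₂ _)          ()
  code-injective (inj₂ _)          (inj₁ _)          ()

firstStep : {A : Set} → List A → A → A
firstStep []      w = w
firstStep (x ∷ _) _ = x

Linked-strict⇒Unique : {A : Set} {ℓ : Level} {R : Rel A ℓ} → Transitive R → (∀ {x} → ¬ R x x) →
                       ∀ {xs} → Linked R xs → Unique xs
Linked-strict⇒Unique trans irrefl =
  AllPairs.map (λ { r refl → irrefl r }) ∘ Linked⇒AllPairs trans

module WalkProperties (G : Graph) where

  Adj-sym : ∀ {u v} → Adj G u v → Adj G v u
  Adj-sym {u} {v} = subst T (adj-sym G u v)

  _++ᵂ_ : ∀ {u x w d e} → Walk G u x d → Walk G x w e → Walk G u w (d + e)
  here       ++ᵂ q = q
  step u~x p ++ᵂ q = step u~x (p ++ᵂ q)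

  _∷ʳᵂ_ : ∀ {u x w d} → Walk G u x d → Adj G x w → Walk G u w (suc d)
  here       ∷ʳᵂ x~w = step x~w here
  step u~y p ∷ʳᵂ x~w = step u~y (p ∷ʳᵂ x~w)

  reverseᵂ : ∀ {u w d} → Walk G u w d → Walk G w u d
  reverseᵂ here       = here
  reverseᵂ (step u~x p) = reverseᵂ p ∷ʳᵂ Adj-sym u~x

  connected-if-all-reach : (h : V G) → (∀ v → ∃ λ d → Walk G v h d) → Connected G
  connected-if-all-reach h reach v w with reach v | reach w
  ... | d , v⇝h | e , w⇝h = d + e , v⇝h ++ᵂ reverseᵂ w⇝h

module MetricDimension (G : Graph) where

  distances-injective⇒isMDim1 : (w : V G) (δ : V G → ℕ) → (∀ v → DistIs G v w (δ v)) →
                                (∀ {u v} → δ u ≡ δ v → u ≡ v) → {a b : V G} → a ≢ b → IsMDim G 1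
  distances-injective⇒isMDim1 w δ dist δ-injective {a} {b} a≢b =
    ((λ _ → w) , (λ { zero zero _ → refl }) , resolves) , nonempty-if-resolves
    where
    resolves : Resolves G (DistIs G) (λ (_ : Fin 1) → w)
    resolves v₁ v₂ same = δ-injective (same zero (δ v₁) (δ v₂) (dist v₁) (dist v₂))

    nonempty-if-resolves : ∀ k (W : Fin k → V G) → (∀ i j → W i ≡ W j → i ≡ j) →
                           Resolves G (DistIs G) W → 1 ≤ k
    nonempty-if-resolves zero    W _ res = ⊥-elim (a≢b (res a b λ ()))
    nonempty-if-resolves (suc k) W _ _   = s≤s z≤n

module PathProperties (G : Graph) where

  Adj-firstStep : ∀ {v w int} → IsPath G v w int → Adj G v (firstStep int w)
  Adj-firstStep {int = []}    (v~w ∷ _ , _) = v~w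
  Adj-firstStep {int = _ ∷ _} (v~x ∷ _ , _) = v~x

  first-internal≢target : ∀ {v w x int} → IsPath G v w (x ∷ int) → x ≢ w
  first-internal≢target {int = int} (_ , _ ∷ x∉ ∷ _) = All.lookup x∉ (∈-++⁺ʳ int (here refl))

  FirstStepUnique : V G → V G → Set
  FirstStepUnique v w = ∀ {int₀ int₁} → IsPath G v w int₀ → IsPath G v w int₁ →
                        firstStep int₀ w ≡ firstStep int₁ w

  same-first-step⇒equal-or-meet : ∀ {v w int₀ int₁} → IsPath G v w int₀ → IsPath G v w int₁ →
                                   firstStep int₀ w ≡ firstStep int₁ w →
                                   int₀ ≡ int₁ ⊎ ∃ λ x → x ∈ int₀ × x ∈ int₁
  same-first-step⇒equal-or-meet {int₀ = []}    {[]}    _  _  _   = inj₁ refl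
  same-first-step⇒equal-or-meet {int₀ = []}    {_ ∷ _} _  p₁ w≡y = ⊥-elim (first-internal≢target p₁ (sym w≡y))
  same-first-step⇒equal-or-meet {int₀ = _ ∷ _} {[]}    p₀ _  x≡w = ⊥-elim (first-internal≢target p₀ x≡w)
  same-first-step⇒equal-or-meet {int₀ = x ∷ _} {_ ∷ _} _  _  x≡y = inj₂ (x , here refl , here x≡y)

  κ≤1 : ∀ {v w k} → FirstStepUnique v w → HasDisjointPaths G v w k → k ≤ 1
  κ≤1 {k = zero}        _      _ = z≤n
  κ≤1 {k = suc zero}    _      _ = s≤s z≤n
  κ≤1 {k = suc (suc k)} unique (P , isPath , P-injective , disjoint)
    with same-first-step⇒equal-or-meet (isPath zero) (isPath (suc zero))
           (unique (isPath zero) (isPath (suc zero)))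
  ... | inj₁ P₀≡P₁         = ⊥-elim (0≢1+n (P-injective zero (suc zero) P₀≡P₁))
  ... | inj₂ (x , x∈P₀ , x∈P₁) = ⊥-elim (disjoint zero (suc zero) 0≢1+n x x∈P₀ x∈P₁)

  unique-first-step⇒κ≡1 : ∀ {v w int} → v ≢ w → IsPath G v w int → FirstStepUnique v w → KappaIs G v w 1
  unique-first-step⇒κ≡1 {int = int} v≢w path unique =
    v≢w , ((λ _ → int) , (λ _ → path) , (λ { zero zero _ → refl }) , λ { zero zero 0≢0 → ⊥-elim (0≢0 refl) }) ,
    λ _ → κ≤1 unique

module ConnectivityDimension (G : Graph) where

  κ-functional : ∀ {v w k l} → KappaIs G v w k → KappaIs G v w l → k ≡ l
  κ-functional (_ , k-paths , k-max) (_ , l-paths , l-max) = ≤-antisym (l-max _ k-paths) (k-max _ l-paths)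

  module UniformConnectivity {c : ℕ} (κ≡c : ∀ {v w} → v ≢ w → KappaIs G v w c) where

    -- With κ constant off the diagonal, connectivity to w only detects whether a vertex is w.
    ≡-if-same-connectivity-to : ∀ {v₁ v₂ w} → (∀ x y → ConnIs G v₁ w x → ConnIs G v₂ w y → x ≡ y) →
                                 v₁ ≡ w → v₂ ≡ w
    ≡-if-same-connectivity-to {v₂ = v₂} {w} same v₁≡w with v₂ ≟ᶠ w
    ... | yes v₂≡w = v₂≡w
    ... | no  v₂≢w = case same nothing (just c) v₁≡w (κ≡c v₂≢w) of λ ()

    resolves-if-misses-at-most-one : ∀ {k} (W : Fin k → V G) → MissesAtMostOne W → Resolves G (ConnIs G) W
    resolves-if-misses-at-most-one W one v₁ v₂ same with hit-or-missed W v₁ | hit-or-missed W v₂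
    ... | inj₁ (i , refl) | _               = sym (≡-if-same-connectivity-to (same i) refl)
    ... | inj₂ _          | inj₁ (i , refl) = ≡-if-same-connectivity-to (λ x y p q → sym (same i y x q p)) refl
    ... | inj₂ missed₁    | inj₂ missed₂    = one missed₁ missed₂

    misses-at-most-one-if-resolves : ∀ {k} (W : Fin k → V G) → Resolves G (ConnIs G) W → MissesAtMostOne W
    misses-at-most-one-if-resolves W res {a} {b} a-missed b-missed = res a b same
      where
      same : ∀ i x y → ConnIs G a (W i) x → ConnIs G b (W i) y → x ≡ y
      same i nothing  _        a≡Wi _    = ⊥-elim (a-missed i (sym a≡Wi))
      same i (just _) nothing  _    b≡Wi = ⊥-elim (b-missed i (sym b≡Wi))
      same i (just _) (just _) κa   κb   =
        cong just (trans (κ-functional κa (κ≡c (proj₁ κa))) (κ-functional (κ≡c (proj₁ κb)) κb))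

    isCDim : ∀ {k} → n G ≡ suc k → (W : Fin k → V G) → (∀ i j → W i ≡ W j → i ≡ j) →
             MissesAtMostOne W → IsCDim G k
    isCDim n≡1+k W W-injective one =
      (W , W-injective , resolves-if-misses-at-most-one W one) ,
      λ k′ W′ _ res → ≤-pred (subst (_≤ suc k′) n≡1+k
                               (misses-at-most-one⇒≤1+ W′ (misses-at-most-one-if-resolves W′ res)))

≡ᵇ-suc-false : ∀ a → (a ≡ᵇ suc a) ≡ false
≡ᵇ-suc-false zero    = refl
≡ᵇ-suc-false (suc a) = ≡ᵇ-suc-false a

module PathGraph (m : ℕ) where

  adjacent : Fin (suc m) → Fin (suc m) → Bool
  adjacent u v = (toℕ u ≡ᵇ suc (toℕ v)) ∨ (toℕ v ≡ᵇ suc (toℕ u))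

  𝒫 : Graph
  𝒫 = record
    { n        = suc m
    ; nonempty = s≤s z≤n
    ; adj      = adjacent
    ; adj-sym  = λ u v → ∨-comm (toℕ u ≡ᵇ suc (toℕ v)) (toℕ v ≡ᵇ suc (toℕ u))
    ; adj-irr  = λ v → cong₂ _∨_ (≡ᵇ-suc-false (toℕ v)) (≡ᵇ-suc-false (toℕ v))
    }

  open WalkProperties 𝒫
  open MetricDimension 𝒫
  open PathProperties 𝒫
  open ConnectivityDimension 𝒫

  Adj⇒Neighbours : ∀ {u v} → Adj 𝒫 u v → Neighbours (toℕ u) (toℕ v)
  Adj⇒Neighbours = Sum.map (≡ᵇ⇒≡ _ _) (≡ᵇ⇒≡ _ _) ∘ Equivalence.to T-∨

  Neighbours⇒Adj : ∀ {u v} → Neighbours (toℕ u) (toℕ v) → Adj 𝒫 u v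
  Neighbours⇒Adj = Equivalence.from T-∨ ∘ Sum.map (≡⇒≡ᵇ _ _) (≡⇒≡ᵇ _ _)

  walk-to-zero : ∀ {k} (v : V 𝒫) → toℕ v ≡ k → Walk 𝒫 v zero k
  walk-to-zero {zero}  v v≡0   = subst (λ u → Walk 𝒫 u zero 0) (sym (toℕ-injective v≡0)) here
  walk-to-zero {suc k} v v≡1+k =
    step (Neighbours⇒Adj (inj₁ (trans v≡1+k (cong suc (sym (toℕ-fromℕ< k<1+m))))))
         (walk-to-zero (fromℕ< k<1+m) (toℕ-fromℕ< k<1+m))
    where
    k<1+m : k < suc m
    k<1+m = <-trans (≤-reflexive (sym v≡1+k)) (toℕ<n v)

  walk-length-≥ : ∀ {u w e} → Walk 𝒫 u w e → toℕ u ≤ toℕ w + e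
  walk-length-≥ {u} here = m≤m+n (toℕ u) 0
  walk-length-≥ {w = w} (step {d = d} u~x p) =
    ≤-trans (Neighbours⇒≤1+ (Adj⇒Neighbours u~x))
            (≤-trans (s≤s (walk-length-≥ p)) (≤-reflexive (sym (+-suc (toℕ w) d))))

  distance-to-zero : ∀ v → DistIs 𝒫 v zero (toℕ v)
  distance-to-zero v = walk-to-zero v refl , λ _ → walk-length-≥

  connected : Connected 𝒫
  connected = connected-if-all-reach zero λ v → toℕ v , walk-to-zero v refl

  isMDim : 1 ≤ m → IsMDim 𝒫 1
  isMDim 1≤m = distances-injective⇒isMDim1 zero toℕ distance-to-zero toℕ-injective 0≢last
    where
    0≢last : zero ≢ fromℕ m
    0≢last 0≡last = case subst (1 ≤_) (sym (trans (cong toℕ 0≡last) (toℕ-fromℕ m))) 1≤m of λ ()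

  visits-between : ∀ {x w c} xs → Linked (Adj 𝒫) (x ∷ xs ++ w ∷ []) →
                   Between (toℕ x) (toℕ c) (toℕ w) → c ∈ x ∷ xs ++ w ∷ []
  visits-between {x} {c = c} xs chain c-between with toℕ c ≟ℕ toℕ x
  ... | yes c≡x = here (toℕ-injective c≡x)
  visits-between [] (x~w ∷ [-]) c-between | no c≢x =
    there (here (toℕ-injective (Between-self⇒≡ (Between-step (Adj⇒Neighbours x~w) c-between c≢x))))
  visits-between (y ∷ ys) (x~y ∷ chain) c-between | no c≢x =
    there (visits-between ys chain (Between-step (Adj⇒Neighbours x~y) c-between c≢x))

  first-step-not-backwards : ∀ {v w int} → IsPath 𝒫 v w int → ¬ Between (toℕ (firstStep int w)) (toℕ v) (toℕ w)
  first-step-not-backwards {int = []}      (_ , (v≢w ∷ []) ∷ _) v-between =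
    v≢w (toℕ-injective (Between-self⇒≡ v-between))
  first-step-not-backwards {int = _ ∷ int} (_ ∷ chain , v∉ ∷ _) v-between =
    All.lookup v∉ (visits-between int chain v-between) refl

  first-step-unique : ∀ {v w} → FirstStepUnique v w
  first-step-unique p₀ p₁ =
    toℕ-injective (forward-neighbour-unique (Adj⇒Neighbours (Adj-firstStep p₀)) (Adj⇒Neighbours (Adj-firstStep p₁))
                                            (first-step-not-backwards p₀) (first-step-not-backwards p₁))

  Up : V 𝒫 → V 𝒫 → Set
  Up x y = toℕ y ≡ suc (toℕ x)

  ascent : ∀ d (a b : V 𝒫) → d + suc (toℕ a) ≡ toℕ b → ∃ λ int → Linked Up (a ∷ int ++ b ∷ [])
  ascent zero    a b 1+a≡b = [] , sym 1+a≡b ∷ [-]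
  ascent (suc d) a b eq    = a′ ∷ proj₁ rest , toℕ-fromℕ< a′<1+m ∷ proj₂ rest
    where
    a′<1+m : suc (toℕ a) < suc m
    a′<1+m = <-trans (≤-trans (s≤s (m≤n+m (suc (toℕ a)) d)) (≤-reflexive eq)) (toℕ<n b)
    a′ : V 𝒫
    a′ = fromℕ< a′<1+m
    rest : ∃ λ int → Linked Up (a′ ∷ int ++ b ∷ [])
    rest = ascent d a′ b (trans (cong (λ t → d + suc t) (toℕ-fromℕ< a′<1+m)) (trans (+-suc d (suc (toℕ a))) eq))

  descent : ∀ d (a b : V 𝒫) → d + suc (toℕ b) ≡ toℕ a → ∃ λ int → Linked (flip Up) (a ∷ int ++ b ∷ [])
  descent zero    a b 1+b≡a = [] , sym 1+b≡a ∷ [-]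
  descent (suc d) a b eq    = a′ ∷ proj₁ rest , trans (sym eq) (cong suc (sym (toℕ-fromℕ< a′<1+m))) ∷ proj₂ rest
    where
    a′<1+m : d + suc (toℕ b) < suc m
    a′<1+m = <-trans (≤-reflexive eq) (toℕ<n a)
    a′ : V 𝒫
    a′ = fromℕ< a′<1+m
    rest : ∃ λ int → Linked (flip Up) (a′ ∷ int ++ b ∷ [])
    rest = descent d a′ b (sym (toℕ-fromℕ< a′<1+m))

  ascent⇒path : ∀ {a b int} → Linked Up (a ∷ int ++ b ∷ []) → IsPath 𝒫 a b int
  ascent⇒path chain =
    Linked.map (Neighbours⇒Adj ∘ inj₂) chain ,
    Linked-strict⇒Unique {R = _<_ on toℕ} <-trans (<-irrefl refl) (Linked.map (≤-reflexive ∘ sym) chain)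

  descent⇒path : ∀ {a b int} → Linked (flip Up) (a ∷ int ++ b ∷ []) → IsPath 𝒫 a b int
  descent⇒path chain =
    Linked.map (Neighbours⇒Adj ∘ inj₁) chain ,
    Linked-strict⇒Unique {R = flip _<_ on toℕ} (flip <-trans) (<-irrefl refl) (Linked.map (≤-reflexive ∘ sym) chain)

  path-between : ∀ {a b} → a ≢ b → ∃ (IsPath 𝒫 a b)
  path-between {a} {b} a≢b with <-cmp (toℕ a) (toℕ b)
  ... | tri< a<b _ _ = map₂ ascent⇒path (ascent _ a b (m∸n+n≡m a<b))
  ... | tri≈ _ a≡b _ = ⊥-elim (a≢b (toℕ-injective a≡b))
  ... | tri> _ _ b<a = map₂ descent⇒path (descent _ a b (m∸n+n≡m b<a))

  κ≡1 : ∀ {v w} → v ≢ w → KappaIs 𝒫 v w 1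
  κ≡1 v≢w = unique-first-step⇒κ≡1 v≢w (proj₂ (path-between v≢w)) first-step-unique

  missed-by-inject₁⇒last : ∀ {a} → Misses inject₁ a → toℕ a ≡ m
  missed-by-inject₁⇒last {a} missed with m ≟ℕ toℕ a
  ... | yes m≡a = sym m≡a
  ... | no  m≢a = ⊥-elim (missed (lower₁ a m≢a) (inject₁-lower₁ a m≢a))

  isCDim : IsCDim 𝒫 m
  isCDim = UniformConnectivity.isCDim κ≡1 refl inject₁ (λ _ _ → inject₁-injective)
             (λ a-missed b-missed → toℕ-injective (trans (missed-by-inject₁⇒last a-missed)
                                                        (sym (missed-by-inject₁⇒last b-missed))))

corollary2p11 : (p q : ℕ) → 1 ≤ p → 1 ≤ q →
    Σ Graph λ G → Connected G × Σ ℕ λ m → Σ ℕ λ c →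
      IsMDim G m × IsCDim G c × 1 ≤ c × m * q ≤ p * c
corollary2p11 p q 1≤p 1≤q = 𝒫 , connected , 1 , q , isMDim 1≤q , isCDim , 1≤q , *-monoˡ-≤ q 1≤p
  where open PathGraph q
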